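{- Let $a,b,p,q$ be complex numbers with $p\neq 0$, $q\neq 0$, and let $e=pab-qa^2-b^2$. For every non-negative integer $k$, all integers $m$ and $r$, and every integer $n$ with $w_n\neq 0$ and $w_{n-r}\neq 0$, \[ q^{n-r}e\,u_{r-1}\sum_{j=0}^k \frac{u_{m-(n+1)-kr+rj}}{(w_n/w_{n-r})^j} = \frac{w_m w_{n-r}}{(w_n/w_{n-r})^k} - w_n w_{m-(k+1)r}. \]
   Context: The sequence $\{w_n\}=\{w_n(a,b;p,q)\}$ is defined by $w_0=a$, $w_1=b$, $w_n=pw_{n-1}-qw_{n-2}$ for $n\ge 2$, and extended to negative indices by $w_{ -n}=(pw_{ -n+1}-w_{ -n+2})/q$, so that $w_n=pw_{n-1}-qw_{n-2}$ holds for all integers $n$. The sequence $u_n=u_n(p,q)$ is $w_n(1,p;p,q)$, i.e. $u_0=1$, $u_1=p$, $u_n=pu_{n-1}-qu_{n-2}$ for all integers $n$. -}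

module Defs where

open import Level using (_⊔_)
open import Data.Nat using (ℕ; zero; suc)
open import Data.Integer using (ℤ; +_; -[1+_])
open import Data.Product using (_×_; _,_; proj₁)
open import Relation.Nullary using (¬_)
open import Algebra.Bundles using (CommutativeRing)

-- A field: a nontrivial commutative ring with a (total) inverse operation
-- that is a two-sided inverse on every nonzero element (x ⁻¹ for x ≈ 0#
-- is unconstrained and never used).
record Field (c ℓ : Level.Level) : Set (Level.suc (c ⊔ ℓ)) where
  field
    commutativeRing : CommutativeRing c ℓ
  open CommutativeRing commutativeRing public
  field
    _⁻¹      : Carrier → Carrier
    ⁻¹-inverseʳ : ∀ x → ¬ (x ≈ 0#) → x * (x ⁻¹) ≈ 1#
    1≉0      : ¬ (1# ≈ 0#)

module FieldOps {c ℓ} (F : Field c ℓ) where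
  open Field F using (Carrier; _+_; _*_; _-_; 0#; 1#; _⁻¹)

  _^_ : Carrier → ℕ → Carrier
  x ^ zero = 1#
  x ^ suc k = x * (x ^ k)

  _^ℤ_ : Carrier → ℤ → Carrier
  x ^ℤ (+ k) = x ^ k
  x ^ℤ -[1+ k ] = (x ⁻¹) ^ suc k

  sumTo : ℕ → (ℕ → Carrier) → Carrier
  sumTo zero f = f zero
  sumTo (suc k) f = sumTo k f + f (suc k)

  module _ (a b p q : Carrier) where
    -- fwd k = (w_k , w_{k+1})
    fwd : ℕ → Carrier × Carrier
    fwd zero = a , b
    fwd (suc k) with fwd k
    ... | x , y = y , (p * y - q * x)

    -- bwd k = (w_{-k} , w_{-k+1}),  w_{-n} = (p w_{-n+1} - w_{-n+2}) / q
    bwd : ℕ → Carrier × Carrier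
    bwd zero = a , b
    bwd (suc k) with bwd k
    ... | x , y = ((p * x - y) * (q ⁻¹)) , x

    w : ℤ → Carrier
    w (+ k) = proj₁ (fwd k)
    w -[1+ k ] = proj₁ (bwd (suc k))

  u : Carrier → Carrier → ℤ → Carrier
  u p q = w 1# p p q

-- Every sequence f satisfying f(t+2) = p f(t+1) − q f(t) on all of ℤ is determined by f(0) and
-- f(1) (for q ≠ 0), so identities between such sequences reduce to checking two values. This gives
-- Cassini's identity f(t+2) f(t) − f(t+1)² = qᵗ E, and from it the cross-difference identity
-- f(j+s) f(i) − f(i+s) f(j) = qⁱ E u(j−i−1) u(s−1). Taking i = n−r, j = m−r, s = r settles k = 0;
-- the general case is a telescoping induction on k, since w(n−r) ρ⁻ᵏ = w(n) ρ⁻⁽ᵏ⁺¹⁾.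
module Submission where

open import Defs
open import Data.Nat using (ℕ)
open import Data.Integer using (ℤ; +_) renaming (_+_ to _+ℤ_; _-_ to _-ℤ_; _*_ to _*ℤ_)
open import Relation.Nullary using (¬_)

open import Data.Nat using (zero) renaming (suc to sucℕ)
import Data.Nat as ℕ
open import Data.Integer using (-[1+_]; suc)
import Data.Integer.Properties as ℤ
open import Data.Integer.Tactic.RingSolver using (solve-∀)
open import Data.Product using (_×_; _,_; proj₁)
open import Data.Maybe using (Maybe; just; nothing)
open import Relation.Nullary using (yes)
open import Relation.Binary.PropositionalEquality as P using (_≡_)
open import Algebra.Bundles using (CommutativeRing; RawRing)

-- Algebra.Solver.Ring instantiated with integer coefficients, which it needs in order to cancel
-- terms in a ring whose equality is not decidable.
module IntegerCoefficientSolver {c ℓ} (R : CommutativeRing c ℓ) where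

  open CommutativeRing R
  open import Relation.Binary.Reasoning.Setoid setoid
  open import Algebra.Solver.Ring.AlmostCommutativeRing
    using (fromCommutativeRing; _-Raw-AlmostCommutative⟶_)
  open import Algebra.Properties.Monoid.Mult +-monoid using (×-homo-+) renaming (_×_ to _·_)
  open import Algebra.Properties.Semiring.Mult semiring using (×1-homo-*)
  open import Algebra.Properties.Ring ring using (x[y-z]≈xy-xz; [y-z]x≈yx-zx)
  open import Algebra.Properties.AbelianGroup +-abelianGroup using (⁻¹-∙-comm; ⁻¹-anti-homo‿-)
  open import Algebra.Properties.Group +-group using (ε⁻¹≈ε)
  open import Algebra.Properties.CommutativeSemigroup +-commutativeSemigroup using (interchange)

  -- A pair (a , b) stands for the integer a − b. The operations keep one component zero, so
  -- equal integers have identical representations and the solver may compare normal forms by refl.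
  Diff : Set
  Diff = ℕ × ℕ

  canonical : ℕ → ℕ → Diff
  canonical a b = a ℕ.∸ b , b ℕ.∸ a

  Coefficients : RawRing _ _
  Coefficients = record
    { Carrier = Diff
    ; _≈_     = _≡_
    ; _+_     = λ { (a , b) (c , d) → canonical (a ℕ.+ c) (b ℕ.+ d) }
    ; _*_     = λ { (a , b) (c , d) → canonical (a ℕ.* c ℕ.+ b ℕ.* d) (a ℕ.* d ℕ.+ b ℕ.* c) }
    ; -_      = λ { (a , b) → canonical b a }
    ; 0#      = 0 , 0
    ; 1#      = 1 , 0
    }

  ⟦_⟧ : Diff → Carrier
  ⟦ a , b ⟧ = a · 1# - b · 1#

  [x+y]-[z+w]≈[x-z]+[y-w] : ∀ x y z w → (x + y) - (z + w) ≈ (x - z) + (y - w)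
  [x+y]-[z+w]≈[x-z]+[y-w] x y z w = begin
    (x + y) - (z + w)     ≈⟨ +-cong refl (sym (⁻¹-∙-comm z w)) ⟩
    (x + y) + (- z + - w) ≈⟨ interchange x y (- z) (- w) ⟩
    (x - z) + (y - w)     ∎

  [x-y][z-w]≈[xz+yw]-[xw+yz] : ∀ x y z w → (x - y) * (z - w) ≈ (x * z + y * w) - (x * w + y * z)
  [x-y][z-w]≈[xz+yw]-[xw+yz] x y z w = begin
    (x - y) * (z - w)                     ≈⟨ [y-z]x≈yx-zx (z - w) x y ⟩
    x * (z - w) - y * (z - w)             ≈⟨ +-cong (x[y-z]≈xy-xz x z w) (-‿cong (x[y-z]≈xy-xz y z w)) ⟩
    (x * z - x * w) - (y * z - y * w)     ≈⟨ +-cong refl (⁻¹-anti-homo‿- (y * z) (y * w)) ⟩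
    (x * z - x * w) + (y * w - y * z)     ≈⟨ interchange (x * z) (- (x * w)) (y * w) (- (y * z)) ⟩
    (x * z + y * w) + (- (x * w) - y * z) ≈⟨ +-cong refl (⁻¹-∙-comm (x * w) (y * z)) ⟩
    (x * z + y * w) - (x * w + y * z)     ∎

  ⟦canonical⟧ : ∀ a b → ⟦ canonical a b ⟧ ≈ a · 1# - b · 1#
  ⟦canonical⟧ zero     zero     = refl
  ⟦canonical⟧ zero     (sucℕ b) = refl
  ⟦canonical⟧ (sucℕ a) zero     = refl
  ⟦canonical⟧ (sucℕ a) (sucℕ b) = begin
    ⟦ canonical a b ⟧                       ≈⟨ ⟦canonical⟧ a b ⟩
    a · 1# - b · 1#                         ≈⟨ +-identityˡ _ ⟨
    0# + (a · 1# - b · 1#)                  ≈⟨ +-cong (-‿inverseʳ 1#) refl ⟨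
    (1# - 1#) + (a · 1# - b · 1#)           ≈⟨ [x+y]-[z+w]≈[x-z]+[y-w] 1# (a · 1#) 1# (b · 1#) ⟨
    sucℕ a · 1# - sucℕ b · 1#               ∎

  homomorphism : Coefficients -Raw-AlmostCommutative⟶ fromCommutativeRing R
  homomorphism = record
    { ⟦_⟧    = ⟦_⟧
    ; +-homo = λ { (a , b) (c , d) → begin
        ⟦ canonical (a ℕ.+ c) (b ℕ.+ d) ⟧         ≈⟨ ⟦canonical⟧ (a ℕ.+ c) (b ℕ.+ d) ⟩
        (a ℕ.+ c) · 1# - (b ℕ.+ d) · 1#           ≈⟨ +-cong (×-homo-+ 1# a c) (-‿cong (×-homo-+ 1# b d)) ⟩
        (a · 1# + c · 1#) - (b · 1# + d · 1#)     ≈⟨ [x+y]-[z+w]≈[x-z]+[y-w] _ _ _ _ ⟩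
        ⟦ a , b ⟧ + ⟦ c , d ⟧                     ∎ }
    ; *-homo = λ { (a , b) (c , d) → begin
        ⟦ canonical (a ℕ.* c ℕ.+ b ℕ.* d) (a ℕ.* d ℕ.+ b ℕ.* c) ⟧
          ≈⟨ ⟦canonical⟧ (a ℕ.* c ℕ.+ b ℕ.* d) (a ℕ.* d ℕ.+ b ℕ.* c) ⟩
        (a ℕ.* c ℕ.+ b ℕ.* d) · 1# - (a ℕ.* d ℕ.+ b ℕ.* c) · 1#
          ≈⟨ +-cong (×1-homo-+-* a c b d) (-‿cong (×1-homo-+-* a d b c)) ⟩
        (a · 1# * (c · 1#) + b · 1# * (d · 1#)) - (a · 1# * (d · 1#) + b · 1# * (c · 1#))
          ≈⟨ [x-y][z-w]≈[xz+yw]-[xw+yz] _ _ _ _ ⟨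
        ⟦ a , b ⟧ * ⟦ c , d ⟧
          ∎ }
    ; -‿homo = λ { (a , b) → begin
        ⟦ canonical b a ⟧    ≈⟨ ⟦canonical⟧ b a ⟩
        b · 1# - a · 1#      ≈⟨ ⁻¹-anti-homo‿- (a · 1#) (b · 1#) ⟨
        - ⟦ a , b ⟧          ∎ }
    ; 0-homo = -‿inverseʳ 0#
    ; 1-homo = trans (+-cong (+-identityʳ 1#) ε⁻¹≈ε) (+-identityʳ 1#)
    }
    where
    ×1-homo-+-* : ∀ a c b d → (a ℕ.* c ℕ.+ b ℕ.* d) · 1# ≈ a · 1# * (c · 1#) + b · 1# * (d · 1#)
    ×1-homo-+-* a c b d = trans (×-homo-+ 1# (a ℕ.* c) (b ℕ.* d)) (+-cong (×1-homo-* a c) (×1-homo-* b d))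

  coefficient-equality : ∀ x y → Maybe (⟦ x ⟧ ≈ ⟦ y ⟧)
  coefficient-equality (a , b) (c , d) with a ℕ.≟ c | b ℕ.≟ d
  ... | yes P.refl | yes P.refl = just refl
  ... | _          | _          = nothing

  open import Algebra.Solver.Ring Coefficients (fromCommutativeRing R) homomorphism coefficient-equality
    public using (solve; _:=_; _:+_; _:-_; _:*_; _:^_)

ℤ-induction : ∀ {a} (Q : ℤ → Set a) → Q (+ 0) → (∀ t → Q t → Q (suc t)) → (∀ t → Q (suc t) → Q t) →
              ∀ t → Q t
ℤ-induction Q q₀ up down (+ zero)       = q₀
ℤ-induction Q q₀ up down (+ sucℕ k)     = up (+ k) (ℤ-induction Q q₀ up down (+ k))
ℤ-induction Q q₀ up down -[1+ zero ]    = down -[1+ zero ] q₀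
ℤ-induction Q q₀ up down -[1+ sucℕ k ]  = down -[1+ sucℕ k ] (ℤ-induction Q q₀ up down -[1+ k ])

module FieldProperties {c ℓ} (F : Field c ℓ) where

  open Field F
  open FieldOps F
  open import Relation.Binary.Reasoning.Setoid setoid
  open IntegerCoefficientSolver commutativeRing using (solve; _:=_; _:+_; _:-_; _:*_)

  ⁻¹-inverseˡ : ∀ x → ¬ (x ≈ 0#) → x ⁻¹ * x ≈ 1#
  ⁻¹-inverseˡ x x≉0 = trans (*-comm _ _) (⁻¹-inverseʳ x x≉0)

  *-cancelˡ : ∀ {z x y} → ¬ (z ≈ 0#) → z * x ≈ z * y → x ≈ y
  *-cancelˡ {z} {x} {y} z≉0 zx≈zy = begin
    x              ≈⟨ *-identityˡ x ⟨
    1# * x         ≈⟨ *-cong (⁻¹-inverseˡ z z≉0) refl ⟨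
    (z ⁻¹ * z) * x ≈⟨ *-assoc _ _ _ ⟩
    z ⁻¹ * (z * x) ≈⟨ *-cong refl zx≈zy ⟩
    z ⁻¹ * (z * y) ≈⟨ *-assoc _ _ _ ⟨
    (z ⁻¹ * z) * y ≈⟨ *-cong (⁻¹-inverseˡ z z≉0) refl ⟩
    1# * y         ≈⟨ *-identityˡ y ⟩
    y              ∎

  x*[y*x⁻¹]≈y : ∀ x y → ¬ (x ≈ 0#) → x * (y * x ⁻¹) ≈ y
  x*[y*x⁻¹]≈y x y x≉0 = begin
    x * (y * x ⁻¹) ≈⟨ solve 3 (λ x y x⁻¹ → x :* (y :* x⁻¹) := y :* (x :* x⁻¹)) refl x y (x ⁻¹) ⟩
    y * (x * x ⁻¹) ≈⟨ *-cong refl (⁻¹-inverseʳ x x≉0) ⟩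
    y * 1#         ≈⟨ *-identityʳ y ⟩
    y              ∎

  1⁻¹≈1 : 1# ⁻¹ ≈ 1#
  1⁻¹≈1 = trans (sym (*-identityˡ _)) (⁻¹-inverseʳ 1# 1≉0)

  x*y≉0 : ∀ {x y} → ¬ (x ≈ 0#) → ¬ (y ≈ 0#) → ¬ (x * y ≈ 0#)
  x*y≉0 {x} x≉0 y≉0 xy≈0 = y≉0 (*-cancelˡ x≉0 (trans xy≈0 (sym (zeroʳ x))))

  x⁻¹≉0 : ∀ {x} → ¬ (x ≈ 0#) → ¬ (x ⁻¹ ≈ 0#)
  x⁻¹≉0 {x} x≉0 x⁻¹≈0 = 1≉0 (trans (sym (⁻¹-inverseʳ x x≉0)) (trans (*-cong refl x⁻¹≈0) (zeroʳ x)))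

  x^n≉0 : ∀ {x} → ¬ (x ≈ 0#) → ∀ n → ¬ (x ^ n ≈ 0#)
  x^n≉0 x≉0 zero     = 1≉0
  x^n≉0 x≉0 (sucℕ n) = x*y≉0 x≉0 (x^n≉0 x≉0 n)

  ^ℤ-suc : ∀ {x} → ¬ (x ≈ 0#) → ∀ t → x ^ℤ suc t ≈ x * x ^ℤ t
  ^ℤ-suc x≉0 (+ n)             = refl
  ^ℤ-suc {x} x≉0 -[1+ zero ]   = sym (trans (*-cong refl (*-identityʳ _)) (⁻¹-inverseʳ x x≉0))
  ^ℤ-suc {x} x≉0 -[1+ sucℕ n ] = sym (begin
    x * (x ⁻¹ * y) ≈⟨ *-assoc _ _ _ ⟨
    (x * x ⁻¹) * y ≈⟨ *-cong (⁻¹-inverseʳ x x≉0) refl ⟩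
    1# * y         ≈⟨ *-identityˡ y ⟩
    y              ∎)
    where y = (x ⁻¹) ^ sucℕ n

  -- Both sides become a after multiplying by ρᵏ⁺¹.
  b*ρ⁻ᵏ≈a*ρ⁻ᵏ⁻¹ : ∀ {a b} → ¬ (a ≈ 0#) → ¬ (b ≈ 0#) →
                  let ρ = a * b ⁻¹ in ∀ k → b * ((ρ ^ k) ⁻¹) ≈ a * ((ρ ^ sucℕ k) ⁻¹)
  b*ρ⁻ᵏ≈a*ρ⁻ᵏ⁻¹ {a} {b} a≉0 b≉0 k = *-cancelˡ ρᵏ⁺¹≉0 (begin
    (a * b ⁻¹ * ρᵏ) * (b * ρᵏ ⁻¹)     ≈⟨ solve 5 (λ a b⁻¹ b ρᵏ ρ⁻ᵏ → (a :* b⁻¹ :* ρᵏ) :* (b :* ρ⁻ᵏ)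
                                                  := (a :* (b⁻¹ :* b)) :* (ρᵏ :* ρ⁻ᵏ))
                                               refl a (b ⁻¹) b ρᵏ (ρᵏ ⁻¹) ⟩
    (a * (b ⁻¹ * b)) * (ρᵏ * ρᵏ ⁻¹)   ≈⟨ *-cong (*-cong refl (⁻¹-inverseˡ b b≉0)) (⁻¹-inverseʳ ρᵏ ρᵏ≉0) ⟩
    (a * 1#) * 1#                     ≈⟨ trans (*-identityʳ _) (*-identityʳ a) ⟩
    a                                 ≈⟨ x*[y*x⁻¹]≈y (ρ ^ sucℕ k) a ρᵏ⁺¹≉0 ⟨
    ρ ^ sucℕ k * (a * (ρ ^ sucℕ k) ⁻¹) ∎)
    where
    ρ = a * b ⁻¹
    ρᵏ = ρ ^ k
    ρ≉0 = x*y≉0 a≉0 (x⁻¹≉0 b≉0)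
    ρᵏ≉0 = x^n≉0 ρ≉0 k
    ρᵏ⁺¹≉0 = x^n≉0 ρ≉0 (sucℕ k)

  sumTo-cong : ∀ k {f g : ℕ → Carrier} → (∀ j → f j ≈ g j) → sumTo k f ≈ sumTo k g
  sumTo-cong zero     f≈g = f≈g 0
  sumTo-cong (sucℕ k) f≈g = +-cong (sumTo-cong k f≈g) (f≈g (sucℕ k))

  cong≈ : ∀ (f : ℤ → Carrier) {i j} → i ≡ j → f i ≈ f j
  cong≈ f i≡j = reflexive (P.cong f i≡j)

  weighted-telescoping :
    ∀ (g h : ℤ → Carrier) (a b x : Carrier) (r : ℤ) (ι : ℕ → Carrier) →
    ι 0 ≈ 1# → (∀ k → b * ι k ≈ a * ι (sucℕ k)) →
    (∀ m → x * h m ≈ g m * b - a * g (m -ℤ r)) →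
    ∀ k m → x * sumTo k (λ j → h (m -ℤ + k *ℤ r +ℤ r *ℤ + j) * ι j)
            ≈ g m * b * ι k - a * g (m -ℤ (+ k +ℤ + 1) *ℤ r)
  weighted-telescoping g h a b x r ι ι₀ shift step = telescope
    where
    telescope : ∀ k m → x * sumTo k (λ j → h (m -ℤ + k *ℤ r +ℤ r *ℤ + j) * ι j)
                        ≈ g m * b * ι k - a * g (m -ℤ (+ k +ℤ + 1) *ℤ r)
    telescope zero m = begin
      x * (h (m -ℤ + 0 *ℤ r +ℤ r *ℤ + 0) * ι 0)      ≈⟨ *-cong refl (*-cong (cong≈ h (index m r)) ι₀) ⟩
      x * (h m * 1#)                                ≈⟨ *-cong refl (*-identityʳ (h m)) ⟩
      x * h m                                       ≈⟨ step m ⟩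
      g m * b - a * g (m -ℤ r)                      ≈⟨ +-cong (trans (*-cong refl ι₀) (*-identityʳ _))
                                                              (-‿cong (*-cong refl (cong≈ g (index′ m r)))) ⟨
      g m * b * ι 0 - a * g (m -ℤ (+ 0 +ℤ + 1) *ℤ r) ∎
      where
      index : ∀ m r → m -ℤ + 0 *ℤ r +ℤ r *ℤ + 0 ≡ m
      index = solve-∀
      index′ : ∀ m r → m -ℤ (+ 0 +ℤ + 1) *ℤ r ≡ m -ℤ r
      index′ = solve-∀
    telescope (sucℕ k) m = begin
      x * (sumTo k term + term k′)
        ≈⟨ distribˡ x _ _ ⟩
      x * sumTo k term + x * term k′
        ≈⟨ +-cong (*-cong refl (sumTo-cong k (λ j → *-cong (cong≈ h (shifted m r (+ k) (+ j))) refl)))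
                  (trans (sym (*-assoc _ _ _)) (*-cong (*-cong refl (cong≈ h (last m r (+ k)))) refl)) ⟩
      x * sumTo k (λ j → h (m -ℤ r -ℤ + k *ℤ r +ℤ r *ℤ + j) * ι j) + x * h m * ι k′
        ≈⟨ +-cong (telescope k (m -ℤ r)) (*-cong (step m) refl) ⟩
      (g (m -ℤ r) * b * ι k - a * g₂) + (g m * b - a * g (m -ℤ r)) * ι k′
        ≈⟨ +-cong (+-cong (trans (*-assoc _ _ _) (*-cong refl (shift k))) refl) refl ⟩
      (g (m -ℤ r) * (a * ι k′) - a * g₂) + (g m * b - a * g (m -ℤ r)) * ι k′
        ≈⟨ solve 6 (λ g₁ a ι′ g₂ g₀ b → (g₁ :* (a :* ι′) :- a :* g₂) :+ (g₀ :* b :- a :* g₁) :* ι′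
                                       := g₀ :* b :* ι′ :- a :* g₂)
                   refl (g (m -ℤ r)) a (ι k′) g₂ (g m) b ⟩
      g m * b * ι k′ - a * g₂
        ≈⟨ +-cong refl (-‿cong (*-cong refl (cong≈ g (index m r (+ k))))) ⟩
      g m * b * ι k′ - a * g (m -ℤ (+ k′ +ℤ + 1) *ℤ r)
        ∎
      where
      k′ = sucℕ k
      term : ℕ → Carrier
      term j = h (m -ℤ + k′ *ℤ r +ℤ r *ℤ + j) * ι j
      g₂ = g (m -ℤ r -ℤ (+ k +ℤ + 1) *ℤ r)
      shifted : ∀ m r K J → m -ℤ (+ 1 +ℤ K) *ℤ r +ℤ r *ℤ J ≡ m -ℤ r -ℤ K *ℤ r +ℤ r *ℤ J
      shifted = solve-∀
      last : ∀ m r K → m -ℤ (+ 1 +ℤ K) *ℤ r +ℤ r *ℤ (+ 1 +ℤ K) ≡ m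
      last = solve-∀
      index : ∀ m r K → m -ℤ r -ℤ (K +ℤ + 1) *ℤ r ≡ m -ℤ ((+ 1 +ℤ K) +ℤ + 1) *ℤ r
      index = solve-∀

module Recurrence {c ℓ} (F : Field c ℓ) (p q : Field.Carrier F) (q≉0 : ¬ (Field._≈_ F q (Field.0# F))) where

  open Field F
  open FieldOps F
  open FieldProperties F
  open import Relation.Binary.Reasoning.Setoid setoid
  open import Algebra.Properties.Group +-group using (x≈y⇒x∙y⁻¹≈ε)
  open IntegerCoefficientSolver commutativeRing using (solve; _:=_; _:-_; _:*_; _:^_)

  Recurrent : (ℤ → Carrier) → Set ℓ
  Recurrent f = ∀ t → f (suc (suc t)) ≈ p * f (suc t) - q * f t

  recurrent-backward : ∀ {f} → Recurrent f → ∀ t → p * f (suc t) - f (suc (suc t)) ≈ q * f t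
  recurrent-backward {f} rec t = begin
    p * f (suc t) - f (suc (suc t))             ≈⟨ +-cong refl (-‿cong (rec t)) ⟩
    p * f (suc t) - (p * f (suc t) - q * f t)   ≈⟨ solve 2 (λ x y → x :- (x :- y) := y) refl _ _ ⟩
    q * f t                                     ∎

  backward-extension-recurrent : ∀ x y → y ≈ p * x - q * ((p * x - y) * q ⁻¹)
  backward-extension-recurrent x y = begin
    y                                ≈⟨ solve 2 (λ x y → y := x :- (x :- y)) refl (p * x) y ⟩
    p * x - (p * x - y)              ≈⟨ +-cong refl (-‿cong (x*[y*x⁻¹]≈y q (p * x - y) q≉0)) ⟨
    p * x - q * ((p * x - y) * q ⁻¹) ∎

  w-recurrent : ∀ a b → Recurrent (w a b p q)
  w-recurrent a b (+ n)                = refl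
  w-recurrent a b -[1+ zero ]          = backward-extension-recurrent a b
  w-recurrent a b -[1+ sucℕ zero ]     = backward-extension-recurrent _ a
  w-recurrent a b -[1+ sucℕ (sucℕ n) ] = backward-extension-recurrent _ _

  recurrent-shift : ∀ {f} → Recurrent f → ∀ c → Recurrent (λ t → f (t +ℤ c))
  recurrent-shift {f} rec c t = begin
    f (suc (suc t) +ℤ c)                   ≈⟨ cong≈ f (P.trans (ℤ.+-assoc (+ 1) (suc t) c)
                                                         (P.cong suc (ℤ.+-assoc (+ 1) t c))) ⟩
    f (suc (suc (t +ℤ c)))                 ≈⟨ rec (t +ℤ c) ⟩
    p * f (suc (t +ℤ c)) - q * f (t +ℤ c) ≈⟨ +-cong (*-cong refl (cong≈ f (ℤ.+-assoc (+ 1) t c))) refl ⟨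
    p * f (suc t +ℤ c) - q * f (t +ℤ c)   ∎

  recurrent-*ˡ : ∀ {f} → Recurrent f → ∀ x → Recurrent (λ t → x * f t)
  recurrent-*ˡ {f} rec x t = begin
    x * f (suc (suc t))                 ≈⟨ *-cong refl (rec t) ⟩
    x * (p * f (suc t) - q * f t)       ≈⟨ solve 5 (λ p q f₀ f₁ x → x :* (p :* f₁ :- q :* f₀)
                                                     := p :* (x :* f₁) :- q :* (x :* f₀))
                                                 refl p q (f t) (f (suc t)) x ⟩
    p * (x * f (suc t)) - q * (x * f t) ∎

  recurrent-difference : ∀ {f g} → Recurrent f → Recurrent g → Recurrent (λ t → f t - g t)
  recurrent-difference {f} {g} recf recg t = begin
    f (suc (suc t)) - g (suc (suc t))
      ≈⟨ +-cong (recf t) (-‿cong (recg t)) ⟩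
    (p * f (suc t) - q * f t) - (p * g (suc t) - q * g t)
      ≈⟨ solve 6 (λ p q f₀ f₁ g₀ g₁ → (p :* f₁ :- q :* f₀) :- (p :* g₁ :- q :* g₀)
                                       := p :* (f₁ :- g₁) :- q :* (f₀ :- g₀))
                 refl p q (f t) (f (suc t)) (g t) (g (suc t)) ⟩
    p * (f (suc t) - g (suc t)) - q * (f t - g t)
      ∎

  recurrent-unique : ∀ {f g} → Recurrent f → Recurrent g → f (+ 0) ≈ g (+ 0) → f (+ 1) ≈ g (+ 1) →
                     ∀ t → f t ≈ g t
  recurrent-unique {f} {g} recf recg f₀≈g₀ f₁≈g₁ t = proj₁ (ℤ-induction Agree (f₀≈g₀ , f₁≈g₁) up down t)
    where
    Agree : ℤ → Set ℓ
    Agree t = f t ≈ g t × f (suc t) ≈ g (suc t)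
    up : ∀ t → Agree t → Agree (suc t)
    up t (e₀ , e₁) = e₁ , (begin
      f (suc (suc t))         ≈⟨ recf t ⟩
      p * f (suc t) - q * f t ≈⟨ +-cong (*-cong refl e₁) (-‿cong (*-cong refl e₀)) ⟩
      p * g (suc t) - q * g t ≈⟨ recg t ⟨
      g (suc (suc t))         ∎)
    down : ∀ t → Agree (suc t) → Agree t
    down t (e₁ , e₂) = *-cancelˡ q≉0 (begin
      q * f t                         ≈⟨ recurrent-backward recf t ⟨
      p * f (suc t) - f (suc (suc t)) ≈⟨ +-cong (*-cong refl e₁) (-‿cong e₂) ⟩
      p * g (suc t) - g (suc (suc t)) ≈⟨ recurrent-backward recg t ⟩
      q * g t                         ∎) , e₁

  geometric : ∀ {f : ℤ → Carrier} → (∀ t → f (suc t) ≈ q * f t) → ∀ t → f t ≈ q ^ℤ t * f (+ 0)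
  geometric {f} step = ℤ-induction Geometric (sym (*-identityˡ _)) up down
    where
    Geometric : ℤ → Set ℓ
    Geometric t = f t ≈ q ^ℤ t * f (+ 0)
    up : ∀ t → Geometric t → Geometric (suc t)
    up t hyp = begin
      f (suc t)              ≈⟨ step t ⟩
      q * f t                ≈⟨ *-cong refl hyp ⟩
      q * (q ^ℤ t * f (+ 0)) ≈⟨ *-assoc _ _ _ ⟨
      (q * q ^ℤ t) * f (+ 0) ≈⟨ *-cong (^ℤ-suc q≉0 t) refl ⟨
      q ^ℤ suc t * f (+ 0)   ∎
    down : ∀ t → Geometric (suc t) → Geometric t
    down t hyp = *-cancelˡ q≉0 (begin
      q * f t                ≈⟨ step t ⟨
      f (suc t)              ≈⟨ hyp ⟩
      q ^ℤ suc t * f (+ 0)   ≈⟨ *-cong (^ℤ-suc q≉0 t) refl ⟩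
      (q * q ^ℤ t) * f (+ 0) ≈⟨ *-assoc _ _ _ ⟩
      q * (q ^ℤ t * f (+ 0)) ∎)

  characteristic : (ℤ → Carrier) → Carrier
  characteristic f = f (+ 2) * f (+ 0) - f (+ 1) * f (+ 1)

  cassini : ∀ {f} → Recurrent f → ∀ t →
            f (suc (suc t)) * f t - f (suc t) * f (suc t) ≈ q ^ℤ t * characteristic f
  cassini {f} rec = geometric step
    where
    step : ∀ t → f (suc (suc (suc t))) * f (suc t) - f (suc (suc t)) * f (suc (suc t))
                 ≈ q * (f (suc (suc t)) * f t - f (suc t) * f (suc t))
    step t = begin
      f₃ * f₁ - f₂ * f₂               ≈⟨ +-cong (*-cong (rec (suc t)) refl) refl ⟩
      (p * f₂ - q * f₁) * f₁ - f₂ * f₂ ≈⟨ solve 4 (λ p q f₁ f₂ → (p :* f₂ :- q :* f₁) :* f₁ :- f₂ :* f₂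
                                                    := f₂ :* (p :* f₁ :- f₂) :- q :* (f₁ :* f₁))
                                                refl p q f₁ f₂ ⟩
      f₂ * (p * f₁ - f₂) - q * (f₁ * f₁) ≈⟨ +-cong (*-cong refl (recurrent-backward rec t)) refl ⟩
      f₂ * (q * f₀) - q * (f₁ * f₁)     ≈⟨ solve 4 (λ q f₀ f₁ f₂ → f₂ :* (q :* f₀) :- q :* (f₁ :* f₁)
                                                     := q :* (f₂ :* f₀ :- f₁ :* f₁))
                                                 refl q f₀ f₁ f₂ ⟩
      q * (f₂ * f₀ - f₁ * f₁)           ∎
      where
      f₀ = f t
      f₁ = f (suc t)
      f₂ = f (suc (suc t))
      f₃ = f (suc (suc (suc t)))

  U : ℤ → Carrier
  U = u p q

  u-recurrent : Recurrent U
  u-recurrent = w-recurrent 1# p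

  u₋₁≈0 : U -[1+ 0 ] ≈ 0#
  u₋₁≈0 = begin
    (p * 1# - p) * q ⁻¹ ≈⟨ *-cong (x≈y⇒x∙y⁻¹≈ε (*-identityʳ p)) refl ⟩
    0# * q ⁻¹           ≈⟨ zeroˡ _ ⟩
    0#                  ∎

  -- u(s − 1) is the solution with initial values 0, 1, since u₋₁ = 0 and u₀ = 1.
  recurrent-from-zero : ∀ {f} → Recurrent f → f (+ 0) ≈ 0# → ∀ s → f s ≈ f (+ 1) * U (s -ℤ + 1)
  recurrent-from-zero {f} rec f₀≈0 =
    recurrent-unique rec (recurrent-*ˡ (recurrent-shift u-recurrent -[1+ 0 ]) (f (+ 1)))
      (trans f₀≈0 (sym (trans (*-cong refl u₋₁≈0) (zeroʳ _))))
      (sym (*-identityʳ _))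

  cross-difference : ∀ {f} → Recurrent f → ∀ i j s →
    f i * f (s +ℤ j) - f j * f (s +ℤ i) ≈ q ^ℤ i * characteristic f * U (j -ℤ i -ℤ + 1) * U (s -ℤ + 1)
  cross-difference {f} rec i j s = begin
    Δ i j s                                                    ≈⟨ Δ-from-zero i j s ⟩
    Δ i j (+ 1) * U (s -ℤ + 1)                                 ≈⟨ *-cong Δ₁ refl ⟩
    Δ i (i +ℤ + 1) (j -ℤ i) * U (s -ℤ + 1)                     ≈⟨ *-cong (Δ-from-zero i (i +ℤ + 1) (j -ℤ i)) refl ⟩
    Δ i (i +ℤ + 1) (+ 1) * U (j -ℤ i -ℤ + 1) * U (s -ℤ + 1)    ≈⟨ *-cong (*-cong Δ₂ refl) refl ⟩
    q ^ℤ i * characteristic f * U (j -ℤ i -ℤ + 1) * U (s -ℤ + 1) ∎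
    where
    Δ : ℤ → ℤ → ℤ → Carrier
    Δ i j s = f i * f (s +ℤ j) - f j * f (s +ℤ i)

    Δ-from-zero : ∀ i j s → Δ i j s ≈ Δ i j (+ 1) * U (s -ℤ + 1)
    Δ-from-zero i j = recurrent-from-zero
      (recurrent-difference (recurrent-*ˡ (recurrent-shift rec j) (f i))
                            (recurrent-*ˡ (recurrent-shift rec i) (f j)))
      (begin
        f i * f (+ 0 +ℤ j) - f j * f (+ 0 +ℤ i) ≈⟨ +-cong (*-cong refl (cong≈ f (ℤ.+-identityˡ j)))
                                                           (-‿cong (*-cong refl (cong≈ f (ℤ.+-identityˡ i)))) ⟩
        f i * f j - f j * f i                   ≈⟨ x≈y⇒x∙y⁻¹≈ε (*-comm (f i) (f j)) ⟩
        0#                                      ∎)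

    Δ₁ : Δ i j (+ 1) ≈ Δ i (i +ℤ + 1) (j -ℤ i)
    Δ₁ = +-cong (*-cong refl (cong≈ f (index₁ i j)))
                (-‿cong (trans (*-comm _ _) (*-cong (cong≈ f (ℤ.+-comm (+ 1) i)) (cong≈ f (index₂ i j)))))
      where
      index₁ : ∀ i j → + 1 +ℤ j ≡ (j -ℤ i) +ℤ (i +ℤ + 1)
      index₁ = solve-∀
      index₂ : ∀ i j → j ≡ (j -ℤ i) +ℤ i
      index₂ = solve-∀

    Δ₂ : Δ i (i +ℤ + 1) (+ 1) ≈ q ^ℤ i * characteristic f
    Δ₂ = trans (+-cong (*-comm _ _) (-‿cong (*-cong (cong≈ f (ℤ.+-comm i (+ 1))) refl)))
               (trans (+-cong (*-cong (cong≈ f (P.cong suc (ℤ.+-comm i (+ 1)))) refl) refl)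
                      (cassini rec i))

  cross-difference′ : ∀ {f} → Recurrent f → ∀ m n r →
    q ^ℤ (n -ℤ r) * characteristic f * U (r -ℤ + 1) * U (m -ℤ (n +ℤ + 1)) ≈ f m * f (n -ℤ r) - f n * f (m -ℤ r)
  cross-difference′ {f} rec m n r = begin
    q ^ℤ (n -ℤ r) * characteristic f * U (r -ℤ + 1) * U (m -ℤ (n +ℤ + 1))
      ≈⟨ solve 4 (λ Q E Uᵣ Uₘ → Q :* E :* Uᵣ :* Uₘ := Q :* E :* Uₘ :* Uᵣ) refl _ _ _ _ ⟩
    q ^ℤ (n -ℤ r) * characteristic f * U (m -ℤ (n +ℤ + 1)) * U (r -ℤ + 1)
      ≈⟨ *-cong (*-cong refl (cong≈ U (index₁ m n r))) refl ⟩
    q ^ℤ (n -ℤ r) * characteristic f * U ((m -ℤ r) -ℤ (n -ℤ r) -ℤ + 1) * U (r -ℤ + 1)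
      ≈⟨ cross-difference rec (n -ℤ r) (m -ℤ r) r ⟨
    f (n -ℤ r) * f (r +ℤ (m -ℤ r)) - f (m -ℤ r) * f (r +ℤ (n -ℤ r))
      ≈⟨ +-cong (trans (*-comm _ _) (*-cong (cong≈ f (index₂ m r)) refl))
                (-‿cong (trans (*-comm _ _) (*-cong (cong≈ f (index₂ n r)) refl))) ⟩
    f m * f (n -ℤ r) - f n * f (m -ℤ r)
      ∎
    where
    index₁ : ∀ m n r → m -ℤ (n +ℤ + 1) ≡ (m -ℤ r) -ℤ (n -ℤ r) -ℤ + 1
    index₁ = solve-∀
    index₂ : ∀ m r → r +ℤ (m -ℤ r) ≡ m
    index₂ = solve-∀

  characteristic-w : ∀ a b → characteristic (w a b p q) ≈ p * a * b - q * (a ^ 2) - b ^ 2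
  characteristic-w a b = solve 4 (λ p q a b → (p :* b :- q :* a) :* a :- b :* b
                                            := p :* a :* b :- q :* (a :^ 2) :- b :^ 2)
                                 refl p q a b

theorem3 : ∀ {c ℓ} (F : Field c ℓ) → let open Field F in let open FieldOps F in
    (a b p q : Carrier) → ¬ (p ≈ 0#) → ¬ (q ≈ 0#) →
    let e = p * a * b - q * (a ^ 2) - b ^ 2 in
    (k : ℕ) (m r n : ℤ) →
    ¬ (w a b p q n ≈ 0#) → ¬ (w a b p q (n -ℤ r) ≈ 0#) →
    let ρ = w a b p q n * (w a b p q (n -ℤ r) ⁻¹) in
    (q ^ℤ (n -ℤ r)) * e * u p q (r -ℤ + 1)
    * sumTo k (λ j → u p q (m -ℤ (n +ℤ + 1) -ℤ (+ k) *ℤ r +ℤ r *ℤ (+ j)) * ((ρ ^ j) ⁻¹))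
    ≈ w a b p q m * w a b p q (n -ℤ r) * ((ρ ^ k) ⁻¹) - w a b p q n * w a b p q (m -ℤ (+ k +ℤ + 1) *ℤ r)
theorem3 F a b p q _ q≉0 k m r n wₙ≉0 wₙ₋ᵣ≉0 = begin
  x * sumTo k (λ j → U (m -ℤ (n +ℤ + 1) -ℤ + k *ℤ r +ℤ r *ℤ + j) * ι j)
    ≈⟨ *-cong refl (sumTo-cong k (λ j → *-cong (cong≈ U (index m n r (+ k) (+ j))) refl)) ⟩
  x * sumTo k (λ j → h (m -ℤ + k *ℤ r +ℤ r *ℤ + j) * ι j)
    ≈⟨ weighted-telescoping W h A B x r ι 1⁻¹≈1 (b*ρ⁻ᵏ≈a*ρ⁻ᵏ⁻¹ wₙ≉0 wₙ₋ᵣ≉0) base k m ⟩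
  W m * B * ι k - A * W (m -ℤ (+ k +ℤ + 1) *ℤ r) ∎
  where
  open Field F
  open FieldOps F
  open FieldProperties F
  open Recurrence F p q q≉0
  open import Relation.Binary.Reasoning.Setoid setoid

  W : ℤ → Carrier
  W = w a b p q
  A B x : Carrier
  A = W n
  B = W (n -ℤ r)
  x = q ^ℤ (n -ℤ r) * (p * a * b - q * (a ^ 2) - b ^ 2) * U (r -ℤ + 1)
  ι : ℕ → Carrier
  ι j = ((A * B ⁻¹) ^ j) ⁻¹
  h : ℤ → Carrier
  h t = U (t -ℤ (n +ℤ + 1))

  index : ∀ m n r K J → m -ℤ (n +ℤ + 1) -ℤ K *ℤ r +ℤ r *ℤ J ≡ (m -ℤ K *ℤ r +ℤ r *ℤ J) -ℤ (n +ℤ + 1)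
  index = solve-∀

  base : ∀ m → x * h m ≈ W m * B - A * W (m -ℤ r)
  base m = trans (*-cong (*-cong (*-cong refl (sym (characteristic-w a b))) refl) refl)
                 (cross-difference′ (w-recurrent a b) m n r)
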